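{- Let $T$ be a monad on $\mathbf{Set}$ with Kleisli category $\mathbf{Kl}(T)$, free functor $\iota:\mathbf{Set}\to\mathbf{Kl}(T)$ and forgetful functor $|\cdot|:\mathbf{Kl}(T)\to\mathbf{Set}$, and assume $\mathbf{Kl}(T)$ has binary products. Let $\mathbf A^{op}$ be a reflective subcategory of $\mathbf{Kl}(T)$, with inclusion $j:\mathbf A^{op}\to\mathbf{Kl}(T)$ and reflector $r\dashv j$, and assume $\mathbf A^{op}$ has coequalisers. For $(X,R)\in\int\Psi$ let $p_1,p_2:R\to|X|$ be the projections, $p_i':\iota R\to X$ their transposes under $\iota\dashv|\cdot|$, and let $e:\bar{\mathcal S}(X,R)\to rX$ be the equaliser in $\mathbf A$ of $rp_1',rp_2':rX\to r\iota R$ (viewed as $\mathbf A$-morphisms). For a morphism $f:(X,R)\to(Y,S)$ of $\int\Psi$ let $\bar{\mathcal S}f$ be the unique $\mathbf A$-morphism $\bar{\mathcal S}(Y,S)\to\bar{\mathcal S}(X,R)$ with $e_{(X,R)}\circ\bar{\mathcal S}f=rf\circ e_{(Y,S)}$ in $\mathbf A$. Then $\bar{\mathcal S}$ is a functor $\int\Psi\to\mathbf A^{op}$ and it is left adjoint to $\mathrm{Eq}\circ j:\mathbf A^{op}\to\int\Psi$.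
   Context: In $\mathbf{Kl}(T)$ objects are sets, a morphism $X\to Y$ is a function $X\to TY$, $|X|=TX$, $|f|=\mu_Y\circ Tf$, and $\iota$ sends $g$ to $\eta\circ g$. Since $|\cdot|$ is a right adjoint it preserves products, so relations may be taken concretely: $\Psi X$ is the poset of subsets of $|X|\times|X|$, and $\int\Psi$ has objects $(X,R)$ with $R\subseteq|X|\times|X|$ and morphisms $f:(X,R)\to(Y,S)$ the Kleisli morphisms $f:X\to Y$ with $R\subseteq(|f|\times|f|)^{ -1}(S)$. $\mathrm{Eq}:\mathbf{Kl}(T)\to\int\Psi$ sends $X\mapsto(X,=_{|X|})$ and $f\mapsto f$. A relation $R$ is regarded as a set with its two projections. For $f:(X,R)\to(Y,S)$ in $\int\Psi$, the equation $f\circ p_i'=q_i'\circ\iota g$ holds with $g:R\to S$ the restriction of $|f|\times|f|$, which makes the defining universal property of $\bar{\mathcal S}f$ applicable. -}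

module Defs where

open import Data.Product using (Σ; Σ-syntax; _×_; _,_; proj₁; proj₂)
open import Relation.Binary.PropositionalEquality
  using (_≡_; refl; sym; trans; cong)
open import Function using (_∘_; id)

-- Morphisms of Set are compared
-- pointwise (no function extensionality in Agda), so all laws are
-- pointwise and the functor action respects pointwise equality.

record Monad : Set₁ where
  field
    T         : Set → Set
    fmap      : ∀ {A B : Set} → (A → B) → T A → T B
    η         : ∀ {A : Set} → A → T A
    μ         : ∀ {A : Set} → T (T A) → T A
    fmap-cong : ∀ {A B : Set} {f g : A → B} →
                (∀ x → f x ≡ g x) → ∀ t → fmap f t ≡ fmap g t
    fmap-id   : ∀ {A : Set} (t : T A) → fmap id t ≡ t
    fmap-∘    : ∀ {A B C : Set} (g : B → C) (f : A → B) (t : T A) →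
                fmap (g ∘ f) t ≡ fmap g (fmap f t)
    η-nat     : ∀ {A B : Set} (f : A → B) (x : A) → fmap f (η x) ≡ η (f x)
    μ-nat     : ∀ {A B : Set} (f : A → B) (t : T (T A)) →
                fmap f (μ t) ≡ μ (fmap (fmap f) t)
    μ-assoc   : ∀ {A : Set} (t : T (T (T A))) → μ (fmap μ t) ≡ μ (μ t)
    μ-η       : ∀ {A : Set} (t : T A) → μ (η t) ≡ t
    μ-fmapη   : ∀ {A : Set} (t : T A) → μ (fmap η t) ≡ t

module Kleisli (M : Monad) where
  open Monad M public

  KHom : Set → Set → Set
  KHom X Y = X → T Y

  infix 4 _≈_
  _≈_ : ∀ {X Y} → KHom X Y → KHom X Y → Set
  f ≈ g = ∀ x → f x ≡ g x

  ≈-refl : ∀ {X Y} {f : KHom X Y} → f ≈ f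
  ≈-refl x = refl

  ≈-sym : ∀ {X Y} {f g : KHom X Y} → f ≈ g → g ≈ f
  ≈-sym p x = sym (p x)

  ≈-trans : ∀ {X Y} {f g h : KHom X Y} → f ≈ g → g ≈ h → f ≈ h
  ≈-trans p q x = trans (p x) (q x)

  kid : ∀ {X} → KHom X X
  kid = η

  infixr 9 _⊚_
  _⊚_ : ∀ {X Y Z} → KHom Y Z → KHom X Y → KHom X Z
  (g ⊚ f) x = μ (fmap g (f x))

  ∣_∣ : ∀ {X Y} → KHom X Y → T X → T Y
  ∣ f ∣ t = μ (fmap f t)

  ι : ∀ {X Y} → (X → Y) → KHom X Y
  ι g = η ∘ g

  ⊚-congˡ : ∀ {X Y Z} {g g' : KHom Y Z} (f : KHom X Y) → g ≈ g' → g ⊚ f ≈ g' ⊚ f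
  ⊚-congˡ f p x = cong μ (fmap-cong p (f x))

  ⊚-congʳ : ∀ {X Y Z} (g : KHom Y Z) {f f' : KHom X Y} → f ≈ f' → g ⊚ f ≈ g ⊚ f'
  ⊚-congʳ g p x = cong (λ t → μ (fmap g t)) (p x)

  ⊚-assoc : ∀ {W X Y Z} (h : KHom Y Z) (g : KHom X Y) (f : KHom W X) →
            (h ⊚ g) ⊚ f ≈ h ⊚ (g ⊚ f)
  ⊚-assoc h g f x =
    trans (cong μ (fmap-∘ (μ ∘ fmap h) g (f x)))
    (trans (cong μ (fmap-∘ μ (fmap h) (fmap g (f x))))
    (trans (μ-assoc (fmap (fmap h) (fmap g (f x))))
           (cong μ (sym (μ-nat h (fmap g (f x)))))))

  ⊚-idˡ : ∀ {X Y} (f : KHom X Y) → kid ⊚ f ≈ f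
  ⊚-idˡ f x = μ-fmapη (f x)

  ⊚-idʳ : ∀ {X Y} (f : KHom X Y) → f ⊚ kid ≈ f
  ⊚-idʳ f x = trans (cong μ (η-nat f x)) (μ-η (f x))

record KlProducts (M : Monad) : Set₁ where
  open Kleisli M
  field
    _⊗_      : Set → Set → Set
    π₁       : ∀ {A B} → KHom (A ⊗ B) A
    π₂       : ∀ {A B} → KHom (A ⊗ B) B
    ⟨_,_⟩    : ∀ {C A B} → KHom C A → KHom C B → KHom C (A ⊗ B)
    π₁-β     : ∀ {C A B} (f : KHom C A) (g : KHom C B) → π₁ ⊚ ⟨ f , g ⟩ ≈ f
    π₂-β     : ∀ {C A B} (f : KHom C A) (g : KHom C B) → π₂ ⊚ ⟨ f , g ⟩ ≈ g
    ⟨⟩-unique : ∀ {C A B} (f : KHom C A) (g : KHom C B) (h : KHom C (A ⊗ B)) →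
                π₁ ⊚ h ≈ f → π₂ ⊚ h ≈ g → h ≈ ⟨ f , g ⟩

-- A reflective (full) subcategory A^op of Kl(T): objects Ob, inclusion j
-- (fully faithful: A^op(a,b) = Kl(T)(j a, j b)), reflector r ⊣ j given by
-- the universal property of the unit.

record ReflectiveSub (M : Monad) : Set₂ where
  open Kleisli M
  field
    Ob      : Set₁
    j       : Ob → Set
    rObj    : Set → Ob
    unit    : (X : Set) → KHom X (j (rObj X))
    ext     : ∀ {X} {b : Ob} → KHom X (j b) → KHom (j (rObj X)) (j b)
    ext-β   : ∀ {X} {b : Ob} (f : KHom X (j b)) → ext f ⊚ unit X ≈ f
    ext-unique : ∀ {X} {b : Ob} (f : KHom X (j b)) (h : KHom (j (rObj X)) (j b)) →
                 h ⊚ unit X ≈ f → h ≈ ext f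

  AHom : Ob → Ob → Set
  AHom a b = KHom (j a) (j b)

  rMor : ∀ {X Y} → KHom X Y → AHom (rObj X) (rObj Y)
  rMor {X} {Y} f = ext (unit Y ⊚ f)

-- Coequalisers in A^op (= equalisers in A).

record Coequalisers (M : Monad) (S : ReflectiveSub M) : Set₂ where
  open Kleisli M
  open ReflectiveSub S
  field
    coeq       : ∀ {a b : Ob} → AHom a b → AHom a b → Ob
    coeqArr    : ∀ {a b : Ob} (f g : AHom a b) → AHom b (coeq f g)
    coeq-eq    : ∀ {a b : Ob} (f g : AHom a b) → coeqArr f g ⊚ f ≈ coeqArr f g ⊚ g
    coeq-univ  : ∀ {a b c : Ob} (f g : AHom a b) (h : AHom b c) →
                 h ⊚ f ≈ h ⊚ g → AHom (coeq f g) c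
    coeq-fac   : ∀ {a b c : Ob} (f g : AHom a b) (h : AHom b c) (p : h ⊚ f ≈ h ⊚ g) →
                 coeq-univ f g h p ⊚ coeqArr f g ≈ h
    coeq-unique : ∀ {a b c : Ob} (f g : AHom a b) (h : AHom b c) (p : h ⊚ f ≈ h ⊚ g)
                  (k : AHom (coeq f g) c) → k ⊚ coeqArr f g ≈ h → k ≈ coeq-univ f g h p

module Theory (M : Monad) (S : ReflectiveSub M) (C : Coequalisers M S) where
  open Kleisli M
  open ReflectiveSub S
  open Coequalisers C

  ∫Ψ : Set₁
  ∫Ψ = Σ[ X ∈ Set ] (T X → T X → Set)

  ΨHom : ∫Ψ → ∫Ψ → Set
  ΨHom (X , R) (Y , S') = Σ[ f ∈ KHom X Y ] (∀ u v → R u v → S' (∣ f ∣ u) (∣ f ∣ v))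

  _≈Ψ_ : ∀ {A B} → ΨHom A B → ΨHom A B → Set
  f ≈Ψ g = proj₁ f ≈ proj₁ g

  Ψid : ∀ {A} → ΨHom A A
  Ψid {X , R} = kid , λ u v r → subst2 r (μ-fmapη u) (μ-fmapη v)
    where
      subst2 : ∀ {a b a' b'} → R a b → a' ≡ a → b' ≡ b → R a' b'
      subst2 r refl refl = r

  _∘Ψ_ : ∀ {A B C'} → ΨHom B C' → ΨHom A B → ΨHom A C'
  _∘Ψ_ {X , R} {Y , S'} {Z , U} (g , gr) (f , fr) =
    g ⊚ f , λ u v r → subst2 (gr _ _ (fr u v r)) (comp u) (comp v)
    where
      comp : ∀ t → ∣ g ⊚ f ∣ t ≡ ∣ g ∣ (∣ f ∣ t)
      comp t = trans (cong μ (fmap-∘ (λ y → μ (fmap g y)) f t))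
               (trans (cong μ (fmap-∘ μ (fmap g) (fmap f t)))
               (trans (μ-assoc (fmap (fmap g) (fmap f t)))
                      (cong μ (sym (μ-nat g (fmap f t))))))
      subst2 : ∀ {a b a' b'} → U a b → a' ≡ a → b' ≡ b → U a' b'
      subst2 r refl refl = r

  EqObj : Set → ∫Ψ
  EqObj X = X , _≡_

  EqMor : ∀ {X Y} → KHom X Y → ΨHom (EqObj X) (EqObj Y)
  EqMor f = f , λ u v p → cong ∣ f ∣ p

  RSet : ∫Ψ → Set
  RSet (X , R) = Σ[ uv ∈ T X × T X ] R (proj₁ uv) (proj₂ uv)

  p₁' : ∀ (A : ∫Ψ) → KHom (RSet A) (proj₁ A)
  p₁' A ((u , v) , r) = u

  p₂' : ∀ (A : ∫Ψ) → KHom (RSet A) (proj₁ A)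
  p₂' A ((u , v) , r) = v

  S̄ : ∫Ψ → Ob
  S̄ A = coeq (rMor (p₁' A)) (rMor (p₂' A))

  e : ∀ (A : ∫Ψ) → AHom (rObj (proj₁ A)) (S̄ A)
  e A = coeqArr (rMor (p₁' A)) (rMor (p₂' A))

  rMor-cong : ∀ {X Y} {f f' : KHom X Y} → f ≈ f' → rMor f ≈ rMor f'
  rMor-cong {X} {Y} {f} {f'} p =
    ext-unique (unit Y ⊚ f') (rMor f)
      (≈-trans (ext-β (unit Y ⊚ f)) (⊚-congʳ (unit Y) p))

  rMor-⊚ : ∀ {X Y Z} (g : KHom Y Z) (f : KHom X Y) → rMor (g ⊚ f) ≈ rMor g ⊚ rMor f
  rMor-⊚ {X} {Y} {Z} g f = ≈-sym (ext-unique (unit Z ⊚ (g ⊚ f)) (rMor g ⊚ rMor f)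
    (≈-trans (⊚-assoc (rMor g) (rMor f) (unit X))
    (≈-trans (⊚-congʳ (rMor g) (ext-β (unit Y ⊚ f)))
    (≈-trans (≈-sym (⊚-assoc (rMor g) (unit Y) f))
    (≈-trans (⊚-congˡ f (ext-β (unit Z ⊚ g)))
             (⊚-assoc (unit Z) g f))))))

  restr : ∀ {A B} → ΨHom A B → RSet A → RSet B
  restr (f , fr) ((u , v) , r) = (∣ f ∣ u , ∣ f ∣ v) , fr u v r

  sq₁ : ∀ {A B} (f : ΨHom A B) → proj₁ f ⊚ p₁' A ≈ p₁' B ⊚ ι (restr f)
  sq₁ {A} {B} f x = sym (trans (cong μ (η-nat (p₁' B) (restr f x))) (μ-η _))

  sq₂ : ∀ {A B} (f : ΨHom A B) → proj₁ f ⊚ p₂' A ≈ p₂' B ⊚ ι (restr f)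
  sq₂ {A} {B} f x = sym (trans (cong μ (η-nat (p₂' B) (restr f x))) (μ-η _))

  private
    step : ∀ {A B} (f : ΨHom A B) (pA : KHom (RSet A) (proj₁ A)) (pB : KHom (RSet B) (proj₁ B)) →
           proj₁ f ⊚ pA ≈ pB ⊚ ι (restr f) →
           (e B ⊚ rMor (proj₁ f)) ⊚ rMor pA ≈ (e B ⊚ rMor pB) ⊚ rMor (ι (restr f))
    step {A} {B} f pA pB sq =
      ≈-trans (⊚-assoc (e B) (rMor (proj₁ f)) (rMor pA))
      (≈-trans (⊚-congʳ (e B) (≈-sym (rMor-⊚ (proj₁ f) pA)))
      (≈-trans (⊚-congʳ (e B) (rMor-cong sq))
      (≈-trans (⊚-congʳ (e B) (rMor-⊚ pB (ι (restr f))))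
               (≈-sym (⊚-assoc (e B) (rMor pB) (rMor (ι (restr f))))))))

  S̄mor-wd : ∀ {A B} (f : ΨHom A B) →
            (e B ⊚ rMor (proj₁ f)) ⊚ rMor (p₁' A) ≈ (e B ⊚ rMor (proj₁ f)) ⊚ rMor (p₂' A)
  S̄mor-wd {A} {B} f =
    ≈-trans (step f (p₁' A) (p₁' B) (sq₁ f))
    (≈-trans (⊚-congˡ (rMor (ι (restr f))) (coeq-eq (rMor (p₁' B)) (rMor (p₂' B))))
             (≈-sym (step f (p₂' A) (p₂' B) (sq₂ f))))

  S̄mor : ∀ {A B} → ΨHom A B → AHom (S̄ A) (S̄ B)
  S̄mor {A} {B} f = coeq-univ (rMor (p₁' A)) (rMor (p₂' A)) (e B ⊚ rMor (proj₁ f)) (S̄mor-wd f)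

  IsFunctorS̄ : Set₁
  IsFunctorS̄ =
      (∀ {A B} (f g : ΨHom A B) → _≈Ψ_ {A} {B} f g → S̄mor {A} {B} f ≈ S̄mor {A} {B} g)
    × (∀ (A : ∫Ψ) → S̄mor {A} {A} (Ψid {A}) ≈ kid)
    × (∀ {A B C'} (g : ΨHom B C') (f : ΨHom A B) → S̄mor {A} {C'} (_∘Ψ_ {A} {B} {C'} g f)
                                                   ≈ S̄mor {B} {C'} g ⊚ S̄mor {A} {B} f)

  EqJ : Ob → ∫Ψ
  EqJ a = EqObj (j a)

  EqJMor : ∀ {a b} → AHom a b → ΨHom (EqJ a) (EqJ b)
  EqJMor h = EqMor h

  -- S̄ ⊣ Eq ∘ j: a unit, natural w.r.t. S̄ as defined above, which is a
  -- universal arrow from each (X,R) to Eq ∘ j.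
  S̄⊣EqJ : Set₁
  S̄⊣EqJ =
    Σ[ unitΨ ∈ (∀ (A : ∫Ψ) → ΨHom A (EqJ (S̄ A))) ]
        (∀ {A B} (f : ΨHom A B) → _≈Ψ_ {A} {EqJ (S̄ B)} (_∘Ψ_ {A} {EqJ (S̄ A)} {EqJ (S̄ B)} (EqJMor (S̄mor {A} {B} f)) (unitΨ A))
                                   (_∘Ψ_ {A} {B} {EqJ (S̄ B)} (unitΨ B) f))
      × (∀ (A : ∫Ψ) (a : Ob) (g : ΨHom A (EqJ a)) →
           Σ[ h ∈ AHom (S̄ A) a ]
               (_≈Ψ_ {A} {EqJ a} (_∘Ψ_ {A} {EqJ (S̄ A)} {EqJ a} (EqJMor h) (unitΨ A)) g)
             × (∀ (h' : AHom (S̄ A) a) → _≈Ψ_ {A} {EqJ a} (_∘Ψ_ {A} {EqJ (S̄ A)} {EqJ a} (EqJMor h') (unitΨ A)) g → h' ≈ h))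

{-# OPTIONS --safe #-}
-- A morphism S̄(X,R) → a of A^op is, by the coequaliser property of e, a morphism
-- h : r X → a with h ∘ r p₁' = h ∘ r p₂'; by r ⊣ j these correspond to Kleisli maps
-- g : X → j a with g ∘ p₁' = g ∘ p₂', i.e. with |g| u = |g| v whenever R u v, which
-- are exactly the ∫Ψ-morphisms (X,R) → Eq (j a).  The unit is e ∘ unit, and the
-- functor laws for S̄ follow because e is epi in A^op.
module Submission where

open import Defs
open import Level using (0ℓ)
open import Data.Product using (_×_; _,_; proj₁; Σ-syntax)
open import Relation.Binary.Bundles using (Setoid)
import Relation.Binary.Reasoning.Setoid as SetoidReasoning

module KleisliReasoning (M : Monad) where
  open Kleisli M

  homSetoid : Set → Set → Setoid 0ℓ 0ℓ
  homSetoid X Y = record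
    { Carrier       = KHom X Y
    ; _≈_           = _≈_
    ; isEquivalence = record { refl = ≈-refl ; sym = ≈-sym ; trans = ≈-trans }
    }

  module ≈-Reasoning {X Y : Set} = SetoidReasoning (homSetoid X Y)

module ReflectiveProperties (M : Monad) (S : ReflectiveSub M) where
  open Kleisli M
  open ReflectiveSub S
  open KleisliReasoning M

  ext-cong : ∀ {X} {b : Ob} {f f' : KHom X (j b)} → f ≈ f' → ext f ≈ ext f'
  ext-cong {f = f} {f'} p = ext-unique f' (ext f) (≈-trans (ext-β f) p)

  ≈-from-unit : ∀ {X} {b : Ob} {h h' : AHom (rObj X) b} →
                h ⊚ unit X ≈ h' ⊚ unit X → h ≈ h'
  ≈-from-unit {X} {h = h} {h'} p =
    ≈-trans (ext-unique (h' ⊚ unit X) h p) (≈-sym (ext-unique (h' ⊚ unit X) h' ≈-refl))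

  rMor-unit : ∀ {X Y} (f : KHom X Y) → rMor f ⊚ unit X ≈ unit Y ⊚ f
  rMor-unit {Y = Y} f = ext-β (unit Y ⊚ f)

  rMor-id : ∀ {X} → rMor (kid {X}) ≈ kid
  rMor-id {X} = ≈-from-unit (begin
    rMor kid ⊚ unit X ≈⟨ rMor-unit kid ⟩
    unit X ⊚ kid      ≈⟨ ⊚-idʳ (unit X) ⟩
    unit X            ≈⟨ ⊚-idˡ (unit X) ⟨
    kid ⊚ unit X      ∎)
    where open ≈-Reasoning

  ext-⊚-rMor : ∀ {X Y} {b : Ob} (g : KHom Y (j b)) (p : KHom X Y) →
               ext g ⊚ rMor p ≈ ext (g ⊚ p)
  ext-⊚-rMor {X} {Y} g p = ext-unique (g ⊚ p) (ext g ⊚ rMor p) (begin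
    (ext g ⊚ rMor p) ⊚ unit X ≈⟨ ⊚-assoc (ext g) (rMor p) (unit X) ⟩
    ext g ⊚ (rMor p ⊚ unit X) ≈⟨ ⊚-congʳ (ext g) (rMor-unit p) ⟩
    ext g ⊚ (unit Y ⊚ p)      ≈⟨ ⊚-assoc (ext g) (unit Y) p ⟨
    (ext g ⊚ unit Y) ⊚ p      ≈⟨ ⊚-congˡ p (ext-β g) ⟩
    g ⊚ p                     ∎)
    where open ≈-Reasoning

  ext-equalises-rMor : ∀ {X Y} {b : Ob} (g : KHom Y (j b)) {p q : KHom X Y} →
                       g ⊚ p ≈ g ⊚ q → ext g ⊚ rMor p ≈ ext g ⊚ rMor q
  ext-equalises-rMor g {p} {q} gp≈gq = begin
    ext g ⊚ rMor p ≈⟨ ext-⊚-rMor g p ⟩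
    ext (g ⊚ p)    ≈⟨ ext-cong gp≈gq ⟩
    ext (g ⊚ q)    ≈⟨ ext-⊚-rMor g q ⟨
    ext g ⊚ rMor q ∎
    where open ≈-Reasoning

  unit-equalises : ∀ {X Y} {b : Ob} (h : AHom (rObj Y) b) {p q : KHom X Y} →
                   h ⊚ rMor p ≈ h ⊚ rMor q → (h ⊚ unit Y) ⊚ p ≈ (h ⊚ unit Y) ⊚ q
  unit-equalises {X} {Y} h {p} {q} hp≈hq = begin
    (h ⊚ unit Y) ⊚ p          ≈⟨ ⊚-assoc h (unit Y) p ⟩
    h ⊚ (unit Y ⊚ p)          ≈⟨ ⊚-congʳ h (rMor-unit p) ⟨
    h ⊚ (rMor p ⊚ unit X)     ≈⟨ ⊚-assoc h (rMor p) (unit X) ⟨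
    (h ⊚ rMor p) ⊚ unit X     ≈⟨ ⊚-congˡ (unit X) hp≈hq ⟩
    (h ⊚ rMor q) ⊚ unit X     ≈⟨ ⊚-assoc h (rMor q) (unit X) ⟩
    h ⊚ (rMor q ⊚ unit X)     ≈⟨ ⊚-congʳ h (rMor-unit q) ⟩
    h ⊚ (unit Y ⊚ q)          ≈⟨ ⊚-assoc h (unit Y) q ⟨
    (h ⊚ unit Y) ⊚ q          ∎
    where open ≈-Reasoning

module CoequaliserProperties (M : Monad) (S : ReflectiveSub M) (C : Coequalisers M S) where
  open Kleisli M
  open ReflectiveSub S
  open Coequalisers C

  coeqArr-epi : ∀ {a b c : Ob} (f g : AHom a b) {k k' : AHom (coeq f g) c} →
                k ⊚ coeqArr f g ≈ k' ⊚ coeqArr f g → k ≈ k'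
  coeqArr-epi f g {k} {k'} kc≈k'c =
    ≈-trans (coeq-unique f g (k' ⊚ c) k'c-coequalises k kc≈k'c)
            (≈-sym (coeq-unique f g (k' ⊚ c) k'c-coequalises k' ≈-refl))
    where
      c = coeqArr f g
      k'c-coequalises : (k' ⊚ c) ⊚ f ≈ (k' ⊚ c) ⊚ g
      k'c-coequalises =
        ≈-trans (⊚-assoc k' c f)
        (≈-trans (⊚-congʳ k' (coeq-eq f g)) (≈-sym (⊚-assoc k' c g)))

module S̄Properties (M : Monad) (S : ReflectiveSub M) (C : Coequalisers M S) where
  open Kleisli M
  open ReflectiveSub S
  open Coequalisers C
  open Theory M S C
  open KleisliReasoning M
  open ReflectiveProperties M S
  open CoequaliserProperties M S C

  S̄mor-e : ∀ {A B} (f : ΨHom A B) → S̄mor {A} {B} f ⊚ e A ≈ e B ⊚ rMor (proj₁ f)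
  S̄mor-e {A} {B} f = coeq-fac (rMor (p₁' A)) (rMor (p₂' A)) (e B ⊚ rMor (proj₁ f)) (S̄mor-wd f)

  e-epi : ∀ (A : ∫Ψ) {a : Ob} {k k' : AHom (S̄ A) a} → k ⊚ e A ≈ k' ⊚ e A → k ≈ k'
  e-epi A = coeqArr-epi (rMor (p₁' A)) (rMor (p₂' A))

  S̄mor-cong : ∀ {A B} (f g : ΨHom A B) → _≈Ψ_ {A} {B} f g → S̄mor {A} {B} f ≈ S̄mor {A} {B} g
  S̄mor-cong {A} {B} f g f≈g = e-epi A (begin
    S̄mor f ⊚ e A           ≈⟨ S̄mor-e f ⟩
    e B ⊚ rMor (proj₁ f)   ≈⟨ ⊚-congʳ (e B) (rMor-cong f≈g) ⟩
    e B ⊚ rMor (proj₁ g)   ≈⟨ S̄mor-e g ⟨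
    S̄mor g ⊚ e A           ∎)
    where open ≈-Reasoning

  S̄mor-id : ∀ (A : ∫Ψ) → S̄mor {A} {A} (Ψid {A}) ≈ kid
  S̄mor-id A = e-epi A (begin
    S̄mor (Ψid {A}) ⊚ e A   ≈⟨ S̄mor-e (Ψid {A}) ⟩
    e A ⊚ rMor kid         ≈⟨ ⊚-congʳ (e A) rMor-id ⟩
    e A ⊚ kid              ≈⟨ ⊚-idʳ (e A) ⟩
    e A                    ≈⟨ ⊚-idˡ (e A) ⟨
    kid ⊚ e A              ∎)
    where open ≈-Reasoning

  S̄mor-∘ : ∀ {A B C'} (g : ΨHom B C') (f : ΨHom A B) →
           S̄mor {A} {C'} (_∘Ψ_ {A} {B} {C'} g f) ≈ S̄mor {B} {C'} g ⊚ S̄mor {A} {B} f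
  S̄mor-∘ {A} {B} {C'} g f = e-epi A (begin
    S̄mor (_∘Ψ_ {A} {B} {C'} g f) ⊚ e A ≈⟨ S̄mor-e (_∘Ψ_ {A} {B} {C'} g f) ⟩
    e C' ⊚ rMor (g₀ ⊚ f₀)              ≈⟨ ⊚-congʳ (e C') (rMor-⊚ g₀ f₀) ⟩
    e C' ⊚ (rMor g₀ ⊚ rMor f₀)         ≈⟨ ⊚-assoc (e C') (rMor g₀) (rMor f₀) ⟨
    (e C' ⊚ rMor g₀) ⊚ rMor f₀         ≈⟨ ⊚-congˡ (rMor f₀) (S̄mor-e g) ⟨
    (S̄mor g ⊚ e B) ⊚ rMor f₀           ≈⟨ ⊚-assoc (S̄mor g) (e B) (rMor f₀) ⟩
    S̄mor g ⊚ (e B ⊚ rMor f₀)           ≈⟨ ⊚-congʳ (S̄mor g) (S̄mor-e f) ⟨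
    S̄mor g ⊚ (S̄mor f ⊚ e A)            ≈⟨ ⊚-assoc (S̄mor g) (S̄mor f) (e A) ⟨
    (S̄mor g ⊚ S̄mor f) ⊚ e A            ∎)
    where
      open ≈-Reasoning
      g₀ = proj₁ g
      f₀ = proj₁ f

  -- (g ⊚ p₁') ((u , v) , r) and (g ⊚ p₂') ((u , v) , r) reduce to ∣ g ∣ u and ∣ g ∣ v.
  mkΨHom-to-Eq : ∀ (A : ∫Ψ) {Y} (g : KHom (proj₁ A) Y) →
                 g ⊚ p₁' A ≈ g ⊚ p₂' A → ΨHom A (EqObj Y)
  mkΨHom-to-Eq A g gp₁≈gp₂ = g , λ u v r → gp₁≈gp₂ ((u , v) , r)

  ΨHom-to-Eq-coequalises : ∀ (A : ∫Ψ) {Y} (g : ΨHom A (EqObj Y)) →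
                           proj₁ g ⊚ p₁' A ≈ proj₁ g ⊚ p₂' A
  ΨHom-to-Eq-coequalises A (g , g-resp) ((u , v) , r) = g-resp u v r

  unitS̄ : ∀ (A : ∫Ψ) → ΨHom A (EqJ (S̄ A))
  unitS̄ A = mkΨHom-to-Eq A (e A ⊚ unit (proj₁ A))
    (unit-equalises (e A) (coeq-eq (rMor (p₁' A)) (rMor (p₂' A))))

  unitS̄-natural : ∀ {A B} (f : ΨHom A B) →
    _≈Ψ_ {A} {EqJ (S̄ B)} (_∘Ψ_ {A} {EqJ (S̄ A)} {EqJ (S̄ B)} (EqJMor (S̄mor {A} {B} f)) (unitS̄ A))
                         (_∘Ψ_ {A} {B} {EqJ (S̄ B)} (unitS̄ B) f)
  unitS̄-natural {A@(X , _)} {B@(Y , _)} (f , f-resp) = begin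
    S̄mor (f , f-resp) ⊚ (e A ⊚ unit X)   ≈⟨ ⊚-assoc (S̄mor (f , f-resp)) (e A) (unit X) ⟨
    (S̄mor (f , f-resp) ⊚ e A) ⊚ unit X   ≈⟨ ⊚-congˡ (unit X) (S̄mor-e (f , f-resp)) ⟩
    (e B ⊚ rMor f) ⊚ unit X              ≈⟨ ⊚-assoc (e B) (rMor f) (unit X) ⟩
    e B ⊚ (rMor f ⊚ unit X)              ≈⟨ ⊚-congʳ (e B) (rMor-unit f) ⟩
    e B ⊚ (unit Y ⊚ f)                   ≈⟨ ⊚-assoc (e B) (unit Y) f ⟨
    (e B ⊚ unit Y) ⊚ f                   ∎
    where open ≈-Reasoning

  unitS̄-universal : ∀ (A : ∫Ψ) (a : Ob) (g : ΨHom A (EqJ a)) →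
    Σ[ h ∈ AHom (S̄ A) a ]
        (_≈Ψ_ {A} {EqJ a} (_∘Ψ_ {A} {EqJ (S̄ A)} {EqJ a} (EqJMor h) (unitS̄ A)) g)
      × (∀ (h' : AHom (S̄ A) a) → _≈Ψ_ {A} {EqJ a} (_∘Ψ_ {A} {EqJ (S̄ A)} {EqJ a} (EqJMor h') (unitS̄ A)) g → h' ≈ h)
  unitS̄-universal A@(X , _) a (g , g-resp) = h , factorises , unique
    where
      open ≈-Reasoning
      p₁ = rMor (p₁' A)
      p₂ = rMor (p₂' A)

      ext-g-coequalises : ext g ⊚ p₁ ≈ ext g ⊚ p₂
      ext-g-coequalises = ext-equalises-rMor g (ΨHom-to-Eq-coequalises A (g , g-resp))

      h : AHom (S̄ A) a
      h = coeq-univ p₁ p₂ (ext g) ext-g-coequalises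

      factorises : h ⊚ (e A ⊚ unit X) ≈ g
      factorises = begin
        h ⊚ (e A ⊚ unit X)   ≈⟨ ⊚-assoc h (e A) (unit X) ⟨
        (h ⊚ e A) ⊚ unit X   ≈⟨ ⊚-congˡ (unit X) (coeq-fac p₁ p₂ (ext g) ext-g-coequalises) ⟩
        ext g ⊚ unit X       ≈⟨ ext-β g ⟩
        g                    ∎

      unique : ∀ (h' : AHom (S̄ A) a) → h' ⊚ (e A ⊚ unit X) ≈ g → h' ≈ h
      unique h' h'-factorises = e-epi A (≈-from-unit (begin
        (h' ⊚ e A) ⊚ unit X   ≈⟨ ⊚-assoc h' (e A) (unit X) ⟩
        h' ⊚ (e A ⊚ unit X)   ≈⟨ h'-factorises ⟩
        g                     ≈⟨ factorises ⟨
        h ⊚ (e A ⊚ unit X)    ≈⟨ ⊚-assoc h (e A) (unit X) ⟨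
        (h ⊚ e A) ⊚ unit X    ∎))

theorem5 : (M : Monad) → KlProducts M → (S : ReflectiveSub M) → (C : Coequalisers M S) →
    Theory.IsFunctorS̄ M S C × Theory.S̄⊣EqJ M S C
theorem5 M _ S C =
  (S̄mor-cong , S̄mor-id , S̄mor-∘) , (unitS̄ , unitS̄-natural , unitS̄-universal)
  where open S̄Properties M S C
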